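{- Let $G=(V,E)$ be a simple graph and $X\subseteq E$ a non-empty set of edges such that $G[X]$ is not a star graph. Let $M$ be any maximal matching of $G[X]$ and let $C$ be the set of all endpoints of edges of $M$. Then $\mathrm{TSP}^*(C,d_G) \le 3\,\mathrm{OPT}$, where $\mathrm{OPT}$ is the minimum length of a cycle (not necessarily simple) of $G$ covering $X$.
   Context: A cycle (not necessarily simple) of $G$ is a closed walk, possibly a single vertex (length $0$); its length is the number of edges counting repetitions. A cycle covers $X$ if every edge of $X$ has an endpoint among its vertices. $G[X]$ is the subgraph induced by the edge set $X$. A star graph is $K_{1,n}$ for some $n\ge1$. $d_G$ is the shortest-path distance of $G$. $\mathrm{TSP}^*(C,d_G)$ is the minimum, over all Hamiltonian cycles $\langle t_1,\dots,t_k,t_1\rangle$ of the complete graph on $C$, of $\sum_i d_G(t_i,t_{i+1})$. -}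

module Defs where

open import Data.Nat using (ℕ; zero; suc; _≤_)
open import Data.Fin using (Fin)
open import Data.Bool using (Bool; true; false)
open import Data.List using (List; []; _∷_; _++_; [_]; zip)
open import Data.Nat.ListAction using (sum)
open import Data.List.Membership.Propositional using (_∈_)
open import Data.List.Relation.Unary.Unique.Propositional using (Unique)
open import Data.List.Relation.Binary.Pointwise using (Pointwise)
open import Data.Product using (Σ; ∃; ∃-syntax; _×_; _,_)
open import Data.Sum using (_⊎_)
open import Relation.Binary.PropositionalEquality using (_≡_; _≢_)
open import Relation.Nullary using (¬_)
open import Function.Bundles using (_⇔_)

record SimpleGraph (n : ℕ) : Set where
  field
    adj   : Fin n → Fin n → Bool
    sym   : ∀ u v → adj u v ≡ adj v u
    loopless : ∀ v → adj v v ≡ false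
open SimpleGraph public

-- An edge set X ⊆ E(G), given as a symmetric relation on vertices
-- (the unordered edge {u,v} belongs to X iff mem u v ≡ true).
record EdgeSet {n : ℕ} (G : SimpleGraph n) : Set where
  field
    mem    : Fin n → Fin n → Bool
    memSym : ∀ u v → mem u v ≡ mem v u
    ⊆E     : ∀ u v → mem u v ≡ true → adj G u v ≡ true
open EdgeSet public

NonEmptyEdges : ∀ {n} {G : SimpleGraph n} → EdgeSet G → Set
NonEmptyEdges {n} X = Σ (Fin n) λ u → Σ (Fin n) λ v → mem X u v ≡ true

-- G[X] (for X nonempty) is a star K_{1,m}, m ≥ 1, iff some vertex c lies on every edge of X.
IsStar : ∀ {n} {G : SimpleGraph n} → EdgeSet G → Set
IsStar {n} X = Σ (Fin n) λ c → ∀ u v → mem X u v ≡ true → (u ≡ c ⊎ v ≡ c)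

IsMatching : ∀ {n} {G : SimpleGraph n} → EdgeSet G → EdgeSet G → Set
IsMatching {n} X M =
  (∀ u v → mem M u v ≡ true → mem X u v ≡ true) ×
  (∀ u v w → mem M u v ≡ true → mem M u w ≡ true → v ≡ w)

-- Maximal: every edge of X shares an endpoint with some edge of M
-- (equivalently, no edge of X can be added keeping a matching).
IsMaximalMatching : ∀ {n} {G : SimpleGraph n} → EdgeSet G → EdgeSet G → Set
IsMaximalMatching {n} X M =
  IsMatching X M ×
  (∀ u v → mem X u v ≡ true →
     Σ (Fin n) λ w → (mem M u w ≡ true ⊎ mem M v w ≡ true))

Endpoint : ∀ {n} {G : SimpleGraph n} → EdgeSet G → Fin n → Set
Endpoint {n} M v = Σ (Fin n) λ u → mem M v u ≡ true

data Walk {n : ℕ} (G : SimpleGraph n) : Fin n → Fin n → ℕ → Set where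
  [] : ∀ {u} → Walk G u u zero
  step : ∀ {u v w k} → adj G u v ≡ true → Walk G v w k → Walk G u w (suc k)

verts : ∀ {n} {G : SimpleGraph n} {u w k} → Walk G u w k → List (Fin n)
verts {u = u} [] = u ∷ []
verts {u = u} (step _ W) = u ∷ verts W

Covers : ∀ {n} {G : SimpleGraph n} {u k} → Walk G u u k → EdgeSet G → Set
Covers {n} W X = ∀ a b → mem X a b ≡ true → (a ∈ verts W ⊎ b ∈ verts W)

IsDist : ∀ {n} → SimpleGraph n → Fin n → Fin n → ℕ → Set
IsDist G u v d = Walk G u v d × (∀ k → Walk G u v k → d ≤ k)

cyclicPairs : ∀ {A : Set} → List A → List (A × A)
cyclicPairs [] = []
cyclicPairs (t ∷ ts) = zip (t ∷ ts) (ts ++ [ t ])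

-- ts lists every element of the vertex set C exactly once
-- (a Hamiltonian cycle of the complete graph on C).
IsTour : ∀ {n} → (Fin n → Set) → List (Fin n) → Set
IsTour {n} C ts = Unique ts × (∀ v → (v ∈ ts) ⇔ C v)

TourCost : ∀ {n} → SimpleGraph n → List (Fin n) → ℕ → Set
TourCost G ts c =
  Σ (List ℕ) λ ds → Pointwise (λ p d → IsDist G (Data.Product.proj₁ p) (Data.Product.proj₂ p) d) (cyclicPairs ts) ds
                    × sum ds ≡ c

-- Walks of a fixed length are decidable, so every walk from a
--      to b of length L gives a shortest walk, i.e. d_G(a,b) exists and is at
--      most L; the triangle inequality follows.
--   2. Shortcutting. If a closed walk P visits every vertex of a decidable set
--      C, then listing the C-vertices of P in order of first visit gives a tour
--      of C whose cost is at most |P|: every sublist of the vertex sequence of P,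
--      routed along shortest paths, costs at most |P| (triangle inequality).
--   3. Matching detours. Inserting, at every vertex x where a step of W starts,
--      the detour x → partner(x) → x turns W into a closed walk of length at
--      most 3k visiting every such x together with its M-partner. Since W covers
--      X ⊇ M and is closed, every M-endpoint is then visited.
-- If k = 0 the covering walk is a single vertex, so G[X] would be a star; hence
-- k > 0 and the theorem is 3 followed by 2.

module Submission where

open import Defs
open import Data.Nat using (ℕ; zero; suc; _≤_; _<_; _*_; _+_; z≤n; s≤s) renaming (_≟_ to _≟ℕ_)
open import Data.Nat.Properties
  using (+-assoc; +-comm; +-identityʳ; ≤∧≢⇒<; *-suc; ≮⇒≥; m≤n⇒m≤1+n; m≤m+n; +-mono-≤; +-monoʳ-≤; ≤-refl; ≤-reflexive; ≤-trans)
open import Data.Fin using (Fin)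
open import Data.Fin.Properties using (_≟_; any?)
open import Data.Bool using (true)
import Data.Bool.Properties as Bool
open import Data.List using (List; []; _∷_; _++_; [_]; zip; filter; deduplicate)
open import Data.Nat.ListAction using (sum)
open import Data.List.Membership.Propositional using (_∈_)
open import Data.List.Membership.Propositional.Properties using (∈-filter⁺; ∈-filter⁻; ∈-deduplicate⁺; ∈-deduplicate⁻)
open import Data.List.Relation.Unary.Any using (here; there)
import Data.List.Relation.Unary.Unique.DecPropositional.Properties as UniqueProperties
open import Data.List.Relation.Binary.Pointwise using (Pointwise; []; _∷_)
open import Data.List.Relation.Binary.Sublist.Propositional using (_⊆_; []; _∷_; _∷ʳ_; ⊆-trans)
open import Data.List.Relation.Binary.Sublist.Propositional.Properties using (filter-⊆)
open import Data.Product using (Σ; _×_; _,_; proj₁; proj₂)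
import Data.Product as Product
open import Data.Sum using (_⊎_; inj₁; inj₂)
import Data.Sum as Sum
open import Data.Empty using (⊥-elim)
open import Relation.Binary.PropositionalEquality using (_≡_; refl; cong)
import Relation.Binary.PropositionalEquality as ≡
open import Relation.Nullary using (¬_; ¬?; Dec; yes; no)
open import Relation.Binary.Definitions using (DecidableEquality)
open import Relation.Nullary.Decidable using (_×-dec_)
open import Relation.Unary using (Decidable)
open import Function using (_∘_)
open import Function.Bundles using (mk⇔)

-- Least witnesses. A decidable predicate on ℕ holding at L holds at a least
-- number d ≤ L; this is what turns "some walk of length L" into a distance.
module _ {P : ℕ → Set} (P? : ∀ k → Dec (P k)) where

  searchBelow : ∀ L → (∀ k → k < L → ¬ P k) ⊎ Σ ℕ λ d → P d × d < L × (∀ k → P k → d ≤ k)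
  searchBelow zero = inj₁ λ _ ()
  searchBelow (suc L) with searchBelow L
  ... | inj₂ (d , pd , d<L , least) = inj₂ (d , pd , m≤n⇒m≤1+n d<L , least)
  ... | inj₁ none with P? L
  ...   | yes pL = inj₂ (L , pL , ≤-refl , λ k pk → ≮⇒≥ (λ k<L → none k k<L pk))
  ...   | no ¬pL = inj₁ noneUpToL
    where
      noneUpToL : ∀ k → k < suc L → ¬ P k
      noneUpToL k (s≤s k≤L) pk with k ≟ℕ L
      ... | yes refl = ¬pL pk
      ... | no k≢L = none k (≤∧≢⇒< k≤L k≢L) pk

  leastWitness : ∀ {L} → P L → Σ ℕ λ d → P d × d ≤ L × (∀ k → P k → d ≤ k)
  leastWitness {L} pL with searchBelow (suc L)
  ... | inj₁ none = ⊥-elim (none L ≤-refl pL)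
  ... | inj₂ (d , pd , s≤s d≤L , least) = d , pd , d≤L , least

deduplicate-⊆ : ∀ {A : Set} (_≟A_ : DecidableEquality A) (xs : List A) → deduplicate _≟A_ xs ⊆ xs
deduplicate-⊆ _≟A_ [] = []
deduplicate-⊆ _≟A_ (x ∷ xs) = refl ∷ ⊆-trans (filter-⊆ (¬? ∘ (x ≟A_)) (deduplicate _≟A_ xs)) (deduplicate-⊆ _≟A_ xs)

module _ {n : ℕ} {G : SimpleGraph n} where

  _++W_ : ∀ {a b c k m} → Walk G a b k → Walk G b c m → Walk G a c (k + m)
  [] ++W Q = Q
  step h P ++W Q = step h (P ++W Q)

  edge : ∀ {a b} → adj G a b ≡ true → Walk G a b 1
  edge h = step h []

  starts : ∀ {a b k} → Walk G a b k → List (Fin n)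
  starts [] = []
  starts {a = a} (step _ W) = a ∷ starts W

  head∈verts : ∀ {a b k} (P : Walk G a b k) → a ∈ verts P
  head∈verts [] = here refl
  head∈verts (step _ _) = here refl

  ∈-++Wˡ : ∀ {a b c k m x} (P : Walk G a b k) {Q : Walk G b c m} → x ∈ verts P → x ∈ verts (P ++W Q)
  ∈-++Wˡ [] {Q} (here refl) = head∈verts Q
  ∈-++Wˡ (step _ P) (here refl) = here refl
  ∈-++Wˡ (step _ P) (there x∈P) = there (∈-++Wˡ P x∈P)

  ∈-++Wʳ : ∀ {a b c k m x} (P : Walk G a b k) {Q : Walk G b c m} → x ∈ verts Q → x ∈ verts (P ++W Q)
  ∈-++Wʳ [] x∈Q = x∈Q
  ∈-++Wʳ (step _ P) x∈Q = there (∈-++Wʳ P x∈Q)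

  verts⊆starts∪end : ∀ {a b k x} (W : Walk G a b k) → x ∈ verts W → x ∈ starts W ⊎ x ≡ b
  verts⊆starts∪end [] (here x≡a) = inj₂ x≡a
  verts⊆starts∪end (step _ W) (here x≡a) = inj₁ (here x≡a)
  verts⊆starts∪end (step _ W) (there x∈W) = Sum.map₁ there (verts⊆starts∪end W x∈W)

  closedVerts⊆starts : ∀ {u k x} (W : Walk G u u (suc k)) → x ∈ verts W → x ∈ starts W
  closedVerts⊆starts W@(step _ _) x∈W with verts⊆starts∪end W x∈W
  ... | inj₁ x∈starts = x∈starts
  ... | inj₂ refl = here refl

module _ {n : ℕ} (G : SimpleGraph n) where

  walk? : ∀ k a b → Dec (Walk G a b k)
  walk? zero a b with a ≟ b
  ... | yes refl = yes []
  ... | no a≢b = no λ { [] → a≢b refl }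
  walk? (suc k) a b with any? (λ v → (adj G a v Bool.≟ true) ×-dec walk? k v b)
  ... | yes (v , h , W) = yes (step h W)
  ... | no none = no λ { (step h W) → none (_ , h , W) }

  shortest : ∀ {a b L} → Walk G a b L → Σ ℕ λ d → IsDist G a b d × d ≤ L
  shortest {a} {b} W with leastWitness (λ k → walk? k a b) W
  ... | d , Wd , d≤L , least = d , (Wd , least) , d≤L

  triangle : ∀ {a b c d e} → IsDist G a b d → IsDist G b c e → Σ ℕ λ f → IsDist G a c f × f ≤ d + e
  triangle (P , _) (Q , _) = shortest (P ++W Q)

  data Route : Fin n → List (Fin n) → Fin n → ℕ → Set where
    end : ∀ {a b d} → IsDist G a b d → Route a [] b d
    cons : ∀ {a t ts b d c} → IsDist G a t d → Route t ts b c → Route a (t ∷ ts) b (d + c)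

  routeLegs : ∀ {a ts b c} → Route a ts b c →
    Σ (List ℕ) λ ds → Pointwise (λ p d → IsDist G (proj₁ p) (proj₂ p) d) (zip (a ∷ ts) (ts ++ [ b ])) ds
                      × sum ds ≡ c
  routeLegs (end {d = d} ab) = d ∷ [] , ab ∷ [] , +-identityʳ d
  routeLegs (cons {d = d} at r) with routeLegs r
  ... | ds , legs , total = d ∷ ds , at ∷ legs , cong (d +_) total

  walk⇒route : ∀ {z a b ℓ L ts} (Q : Walk G z a ℓ) (P : Walk G a b L) → ts ⊆ verts P →
    Σ ℕ λ c → Route z ts b c × c ≤ ℓ + L
  walk⇒route {ℓ = ℓ} Q [] (_ ∷ʳ []) with shortest Q
  ... | d , zb , d≤ℓ = d , end zb , ≤-trans d≤ℓ (m≤m+n ℓ 0)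
  walk⇒route Q [] (refl ∷ []) with shortest Q | shortest []
  ... | d , za , d≤ℓ | e , aa , e≤0 = d + e , cons za (end aa) , +-mono-≤ d≤ℓ e≤0
  walk⇒route {ℓ = ℓ} Q (step {k = L} h P) (_ ∷ʳ ts⊆P) with walk⇒route (Q ++W edge h) P ts⊆P
  ... | c , r , c≤ = c , r , ≤-trans c≤ (≤-reflexive (+-assoc ℓ 1 L))
  walk⇒route Q (step h P) (refl ∷ ts⊆P) with shortest Q | walk⇒route (edge h) P ts⊆P
  ... | d , za , d≤ℓ | c , r , c≤ = d + c , cons za r , +-mono-≤ d≤ℓ c≤

  redirect : ∀ {a ts v t c e} → Route a ts v c → IsDist G v t e → Σ ℕ λ c' → Route a ts t c' × c' ≤ c + e
  redirect (end av) vt with triangle av vt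
  ... | f , at , f≤ = f , end at , f≤
  redirect {c = .(d + c)} {e} (cons {d = d} {c = c} as r) vt with redirect r vt
  ... | c' , r' , c'≤ = d + c' , cons as r' , ≤-trans (+-monoʳ-≤ d c'≤) (≤-reflexive (≡.sym (+-assoc d c e)))

  -- A sublist of the vertices of a closed walk, read cyclically, costs at most
  -- the length of the walk: route it from the walk's base and close it up.
  closedWalk⇒tourCost : ∀ {v L ts} (P : Walk G v v L) → ts ⊆ verts P → Σ ℕ λ c → TourCost G ts c × c ≤ L
  closedWalk⇒tourCost {ts = []} P _ = 0 , ([] , [] , refl) , z≤n
  closedWalk⇒tourCost {ts = t ∷ ts} P ts⊆P with walk⇒route [] P ts⊆P
  ... | _ , cons {d = d} {c = c} vt r , c≤L with redirect r vt
  ...   | c' , r' , c'≤ = c' , routeLegs r' , ≤-trans c'≤ (≤-trans (≤-reflexive (+-comm c d)) c≤L)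

  shortcut : (C : Fin n → Set) → Decidable C → ∀ {v L} (P : Walk G v v L) → (∀ x → C x → x ∈ verts P) →
    Σ (List (Fin n)) λ ts → IsTour C ts × Σ ℕ λ c → TourCost G ts c × c ≤ L
  shortcut C C? P visits =
    ts , (UniqueProperties.deduplicate-! _≟_ Cvs , λ x → mk⇔ (inC x) (inTs x)) , closedWalk⇒tourCost P ts⊆P
    where
      Cvs : List (Fin n)
      Cvs = filter C? (verts P)
      ts : List (Fin n)
      ts = deduplicate _≟_ Cvs
      inC : ∀ x → x ∈ ts → C x
      inC x x∈ts = proj₂ (∈-filter⁻ C? {xs = verts P} (∈-deduplicate⁻ _≟_ Cvs x∈ts))
      inTs : ∀ x → C x → x ∈ ts
      inTs x cx = ∈-deduplicate⁺ _≟_ (∈-filter⁺ C? (visits x cx) cx)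
      ts⊆P : ts ⊆ verts P
      ts⊆P = ⊆-trans (deduplicate-⊆ _≟_ Cvs) (filter-⊆ C? (verts P))

pointCover⇒star : ∀ {n} {G : SimpleGraph n} {u} (X : EdgeSet G) → Covers {G = G} {u = u} [] X → IsStar X
pointCover⇒star {u = u} X cov = u , onU
  where
    onU : ∀ a b → mem X a b ≡ true → a ≡ u ⊎ b ≡ u
    onU a b ab∈X with cov a b ab∈X
    ... | inj₁ (here a≡u) = inj₁ a≡u
    ... | inj₂ (here b≡u) = inj₂ b≡u

endpoint? : ∀ {n} {G : SimpleGraph n} (M : EdgeSet G) → Decidable (Endpoint M)
endpoint? M v = any? (λ w → mem M v w Bool.≟ true)

Serves : ∀ {n} {G : SimpleGraph n} (M : EdgeSet G) {a b L} → Walk G a b L → Fin n → Set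
Serves M P x = x ∈ verts P × (∀ y → mem M x y ≡ true → y ∈ verts P)

module _ {n : ℕ} {G : SimpleGraph n} (M : EdgeSet G)
         (partner-unique : ∀ u v w → mem M u v ≡ true → mem M u w ≡ true → v ≡ w) where

  detour : ∀ x → Σ ℕ λ m → Σ (Walk G x x m) λ D → m ≤ 2 × (∀ y → mem M x y ≡ true → y ∈ verts D)
  detour x with endpoint? M x
  ... | no unmatched = 0 , [] , z≤n , λ y xy∈M → ⊥-elim (unmatched (y , xy∈M))
  ... | yes (y , xy∈M) = 2 , there-and-back , ≤-refl , partnerVisited
    where
      xy : adj G x y ≡ true
      xy = ⊆E M x y xy∈M
      yx : adj G y x ≡ true
      yx = ≡.trans (sym G y x) xy
      there-and-back : Walk G x x 2
      there-and-back = step xy (step yx [])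
      partnerVisited : ∀ y' → mem M x y' ≡ true → y' ∈ verts there-and-back
      partnerVisited y' xy'∈M = there (here (partner-unique x y' y xy'∈M xy∈M))

  augment : ∀ {a b k} (W : Walk G a b k) →
    Σ ℕ λ L → Σ (Walk G a b L) λ P → L ≤ 3 * k × (∀ x → x ∈ starts W → Serves M P x)
  augment [] = 0 , [] , z≤n , λ _ ()
  augment (step {u} {k = k} h W) with detour u | augment W
  ... | m , D , m≤2 , partners | L , P , L≤3k , serves =
    m + suc L , D ++W step h P , length≤ , served
    where
      length≤ : m + suc L ≤ 3 * suc k
      length≤ = ≤-trans (+-mono-≤ m≤2 (s≤s L≤3k)) (≤-reflexive (≡.sym (*-suc 3 k)))
      served : ∀ x → x ∈ u ∷ starts W → Serves M (D ++W step h P) x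
      served x (here refl) = ∈-++Wˡ D (head∈verts D) , λ y xy∈M → ∈-++Wˡ D (partners y xy∈M)
      served x (there x∈W) = Product.map lift (λ partnersP y → lift ∘ partnersP y) (serves x x∈W)
        where
          lift : ∀ {z} → z ∈ verts P → z ∈ verts (D ++W step h P)
          lift = ∈-++Wʳ D ∘ there

-- If a closed walk W of positive length covers X ⊇ M, any walk serving the
-- starts of W visits every M-endpoint: of each M-edge, W meets an endpoint.
endpointsVisited : ∀ {n} {G : SimpleGraph n} (X M : EdgeSet G) → IsMatching X M →
  ∀ {u k} (W : Walk G u u (suc k)) → Covers W X →
  ∀ {a b L} (P : Walk G a b L) → (∀ x → x ∈ starts W → Serves M P x) →
  ∀ x → Endpoint M x → x ∈ verts P
endpointsVisited X M (M⊆X , _) W cov P serves x (x' , xx'∈M) with cov x x' (M⊆X x x' xx'∈M)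
... | inj₁ x∈W = proj₁ (serves x (closedVerts⊆starts W x∈W))
... | inj₂ x'∈W = proj₂ (serves x' (closedVerts⊆starts W x'∈W)) x (≡.trans (memSym M x' x) xx'∈M)

theorem3 : ∀ {n} (G : SimpleGraph n) (X : EdgeSet G) → NonEmptyEdges X → ¬ IsStar X →
    (M : EdgeSet G) → IsMaximalMatching X M →
    ∀ {u k} (W : Walk G u u k) → Covers W X →
    Σ (List (Fin n)) λ ts → IsTour (Endpoint M) ts × Σ ℕ λ c → TourCost G ts c × c ≤ 3 * k
theorem3 _ X _ notStar M _ [] cov = ⊥-elim (notStar (pointCover⇒star X cov))
theorem3 G X _ _ M (matching , _) W@(step _ _) cov with augment M (proj₂ matching) W
... | L , P , L≤3k , serves
  with shortcut G (Endpoint M) (endpoint? M) P (endpointsVisited X M matching W cov P serves)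
...   | ts , tour , c , cost , c≤L = ts , tour , c , cost , ≤-trans c≤L L≤3k
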